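{- Let $f=(\alpha_1\alpha_2\cdots\alpha_n)$ be an $n$-player rule, and let $m<n$ be a positive integer such that $\mathrm{ord}_fP\leqslant m$ for every $P\in\mathcal{L}$. Let $g=(\alpha_1\alpha_2\cdots\alpha_m)$ be the $m$-player rule. Then $f\sim g$, i.e. $\mathrm{ord}_fP=\mathrm{ord}_gP$ for all $P\in\mathcal{L}$.
   Context: Positions are finite tuples $P=(a_1,\dots,a_k)$ of integers with $a_1\geqslant\dots\geqslant a_k\geqslant0$, where tuples differing only by trailing zeros are identified. $(0)$ is the empty position, $\mathcal{L}$ is the set of positions other than $(0)$, and $|P|=\sum a_i$ is the volume of $P$. A chomp move $P\to Q$ from $P=(a_1,\dots,a_k)$ chooses $1\leqslant x\leqslant k$ and an integer $a\geqslant0$, and sets $Q=(b_1,\dots,b_k)$ with $b_j=a_j$ for $j<x$ and $b_j=\min(a_j,a)$ for $j\geqslant x$, where $Q$ must be a different position from $P$. Write $\mathrm{Mov}P=\{Q:P\to Q\}$. An $n$-player rule ($n\geqslant1$) is a tuple $f=(\alpha_1\cdots\alpha_n)$ of distinct real numbers. Ordinals $\mathrm{ord}_f$ are defined recursively on volume as follows. - $\mathrm{ord}_f(0)=0$. - For a position $Q$, set $s_f(Q)=\alpha_{\mathrm{ord}_fQ+1}$ if $\mathrm{ord}_fQ<n$ and $s_f(Q)=\alpha_1$ if $\mathrm{ord}_fQ=n$. - For $P\in\mathcal{L}$, $\mathrm{ord}_fP$ is the unique $i\in\{1,\dots,n\}$ with $\alpha_i=\max_{Q\in\mathrm{Mov}P}s_f(Q)$.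 Two rules $f,g$ (possibly with different numbers of players) are isomorphic, written $f\sim g$, if $\mathrm{ord}_fP=\mathrm{ord}_gP$ for all $P\in\mathcal{L}$. -}

module Defs where

open import Level using (Level)
open import Data.Nat using (ℕ; zero; suc; _+_; _⊓_; _<_; _≤_; _<?_)
open import Data.Nat.Properties using () renaming (_≟_ to _≟ℕ_)
open import Data.Fin using (Fin; toℕ; fromℕ<)
import Data.Fin as F
open import Data.List using (List; []; _∷_; length; map; filter; take; drop; _++_; upTo; concatMap)
open import Data.Nat.ListAction using (sum)
open import Data.List.Properties using (≡-dec)
open import Data.List.Relation.Unary.All using (All)
open import Data.List.Relation.Unary.Linked using (Linked)
open import Data.Maybe using (Maybe; just; nothing)
open import Relation.Binary.Bundles using (StrictTotalOrder)
open import Relation.Binary.Definitions using (tri<; tri≈; tri>)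
open import Relation.Binary.PropositionalEquality using (_≡_)
open import Relation.Nullary using (¬_; yes; no)
open import Relation.Nullary.Decidable using (¬?)

-- A position (a₁ ≥ … ≥ a_k ≥ 0) modulo trailing zeros is
-- represented canonically by the list of its NONZERO entries, which is
-- non-increasing.  The empty position (0) is the empty list [].

IsPosition : List ℕ → Set
IsPosition P = Linked (λ a b → b ≤ a) P × All (λ a → 0 < a) P
  where open import Data.Product using (_×_)

InL : List ℕ → Set
InL P = IsPosition P × ¬ (P ≡ [])
  where open import Data.Product using (_×_)

volume : List ℕ → ℕ
volume = sum

normalize : List ℕ → List ℕ
normalize = filter (λ a → 0 <? a)

-- the chomp move with parameters x = i + 1 (i < k) and a:
-- b_j = a_j for j < x, b_j = min(a_j, a) for j ≥ x
chompMove : ℕ → ℕ → List ℕ → List ℕ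
chompMove i a P = normalize (take i P ++ map (_⊓ a) (drop i P))

-- Any a ≥ a₁ yields
-- Q = P, so it suffices to let a range over 0..|P| (since a₁ ≤ |P|);
-- candidates equal to P are removed.  (Duplicates are harmless.)
Mov : List ℕ → List (List ℕ)
Mov P = filter (λ Q → ¬? (≡-dec _≟ℕ_ Q P))
          (concatMap (λ i → map (λ a → chompMove i a P) (upTo (suc (volume P))))
                     (upTo (length P)))

module Ordinal {c ℓ₁ ℓ₂ : Level} (O : StrictTotalOrder c ℓ₁ ℓ₂) where
  open StrictTotalOrder O using (_≈_; compare) renaming (Carrier to V)

  -- an n-player rule (α₁ … αₙ) is given by α : Fin n → V, with
  -- α (fromℕ (i-1)) = α_i; distinctness is an extra hypothesis
  Distinct : {n : ℕ} → (Fin n → V) → Set _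
  Distinct {n} α = ∀ i j → α i ≈ α j → i ≡ j

  -- the 0-based index of s_f(Q) given o = ord_f Q ∈ {0,…,n}:
  -- α_{o+1} if o < n, α₁ if o = n
  sIndex : {n : ℕ} → ℕ → Fin (suc n)
  sIndex {n} o with o <? suc n
  ... | yes o<n = fromℕ< o<n
  ... | no  _   = F.zero

  best : {k : ℕ} → (Fin k → V) → List (Fin k) → Maybe (Fin k)
  best α []       = nothing
  best α (i ∷ is) with best α is
  ... | nothing = just i
  ... | just j with compare (α i) (α j)
  ...   | tri< _ _ _ = just j
  ...   | tri≈ _ _ _ = just i
  ...   | tri> _ _ _ = just i

  -- ord with fuel; moves strictly decrease volume, so fuel |P| + 1
  -- suffices to evaluate the recursion on volume completely.
  ordFuel : (n : ℕ) → (Fin n → V) → ℕ → List ℕ → ℕ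
  ordFuel zero    α _          P = 0
  ordFuel (suc n) α zero       P = 0
  ordFuel (suc n) α (suc fuel) P
    with best α (map (λ Q → sIndex {n} (ordFuel (suc n) α fuel Q)) (Mov P))
  ... | nothing = 0                 -- only for P = (0): ord_f(0) = 0
  ... | just i  = suc (toℕ i)       -- ord_f P = i with α_i = max s_f(Q)

  ord : (n : ℕ) → (Fin n → V) → List ℕ → ℕ
  ord n α P = ordFuel n α (suc (volume P)) P

{-# OPTIONS --safe #-}
module Submission where

-- By induction on volume, f and g agree on every move Q of a position P,
-- and all these ordinals are at most m, so s_f(Q) = s_g(Q) except when
-- ord Q = m, where s_f(Q) = α_{m+1} but s_g(Q) = α₁.  The empty position
-- is always a move, so α₁ already occurs among the values s_f(Q);
-- trading α_{m+1} for α₁ could only change the maximum if α_{m+1} were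
-- it, i.e. if ord_f P = m + 1 > m.

open import Defs
open import Level using (Level)
open import Data.Nat using (ℕ; zero; suc; _+_; _⊓_; _<_; _≤_; _≥_; _<?_; z≤n; s≤s; s≤s⁻¹)
open import Data.Nat.Properties
  using (≤-trans; <⇒≤; <⇒≢; <-≤-trans; ≤-<-trans; n<1+n; m≤n⇒m<n∨m≡n; +-mono-≤; +-monoʳ-≤;
         +-mono-<-≤; +-cancelˡ-≡; m⊓n≤m; ⊓-monoˡ-≤; ⊓-zeroʳ)
  renaming (_≟_ to _≟ℕ_)
open import Data.Fin using (Fin; toℕ; inject≤)
import Data.Fin as F
open import Data.Fin.Properties using (toℕ-injective; toℕ-inject≤; toℕ-fromℕ<)
open import Data.List using (List; []; _∷_; map; take; drop; _++_; upTo; length)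
open import Data.List.Properties using (filter-all; ≡-dec; map-cong-local; map-∘)
open import Data.Nat.ListAction using (sum)
open import Data.List.Relation.Unary.All using (All; []; _∷_)
import Data.List.Relation.Unary.All as All
import Data.List.Relation.Unary.All.Properties as All
open import Data.List.Relation.Unary.Any using (here; there; satisfied)
open import Data.List.Relation.Unary.AllPairs using (AllPairs; []; _∷_)
import Data.List.Relation.Unary.Linked.Properties as Linked
open import Data.List.Membership.Propositional using (_∈_)
open import Data.List.Membership.Propositional.Properties
  using (∈-map⁺; ∈-map⁻; ∈-filter⁺; ∈-filter⁻; ∈-concatMap⁻)
open import Data.Maybe using (Maybe; just; nothing)
open import Data.Product using (∃-syntax; _×_; _,_; proj₁; proj₂)
open import Data.Sum using (inj₁; inj₂)
open import Function using (_∘_; flip; case_of_)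
open import Relation.Binary.Bundles using (StrictTotalOrder)
open import Relation.Binary.Definitions using (tri<; tri≈; tri>)
open import Relation.Binary.PropositionalEquality
open import Relation.Nullary using (¬_; yes; no; contradiction)
open import Relation.Nullary.Decidable using (¬?)

private
  variable
    m n o p : ℕ

m≤n⇒o≤p⇒m+o≡n+p⇒m≡n : m ≤ n → o ≤ p → m + o ≡ n + p → m ≡ n
m≤n⇒o≤p⇒m+o≡n+p⇒m≡n m≤n o≤p eq with m≤n⇒m<n∨m≡n m≤n
... | inj₁ m<n = contradiction eq (<⇒≢ (+-mono-<-≤ m<n o≤p))
... | inj₂ m≡n = m≡n

sum-normalize : ∀ L → sum (normalize L) ≡ sum L
sum-normalize []          = refl
sum-normalize (zero ∷ L)  = sum-normalize L
sum-normalize (suc a ∷ L) = cong (suc a +_) (sum-normalize L)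

truncateFrom : ℕ → ℕ → List ℕ → List ℕ
truncateFrom i a P = take i P ++ map (_⊓ a) (drop i P)

sum-truncateFrom-≤ : ∀ i a P → sum (truncateFrom i a P) ≤ sum P
sum-truncateFrom-≤ zero    _ []      = z≤n
sum-truncateFrom-≤ (suc _) _ []      = z≤n
sum-truncateFrom-≤ zero    a (x ∷ P) = +-mono-≤ (m⊓n≤m x a) (sum-truncateFrom-≤ zero a P)
sum-truncateFrom-≤ (suc i) a (x ∷ P) = +-monoʳ-≤ x (sum-truncateFrom-≤ i a P)

sum-truncateFrom-≡⇒≡ : ∀ i a P → sum (truncateFrom i a P) ≡ sum P → truncateFrom i a P ≡ P
sum-truncateFrom-≡⇒≡ zero    _ []      _  = refl
sum-truncateFrom-≡⇒≡ (suc _) _ []      _  = refl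
sum-truncateFrom-≡⇒≡ zero    a (x ∷ P) eq = cong₂ _∷_ x⊓a≡x
    (sum-truncateFrom-≡⇒≡ zero a P (+-cancelˡ-≡ x _ _ (trans (cong (_+ _) (sym x⊓a≡x)) eq)))
  where
  x⊓a≡x : x ⊓ a ≡ x
  x⊓a≡x = m≤n⇒o≤p⇒m+o≡n+p⇒m≡n (m⊓n≤m x a) (sum-truncateFrom-≤ zero a P) eq
sum-truncateFrom-≡⇒≡ (suc i) a (x ∷ P) eq =
  cong (x ∷_) (sum-truncateFrom-≡⇒≡ i a P (+-cancelˡ-≡ x _ _ eq))

All-≤-truncateFrom : ∀ i a P → All (_≤ n) P → All (_≤ n) (truncateFrom i a P)
All-≤-truncateFrom zero    _ []      []         = []
All-≤-truncateFrom (suc _) _ []      []         = []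
All-≤-truncateFrom zero    a (x ∷ P) (x≤ ∷ P≤) = ≤-trans (m⊓n≤m x a) x≤ ∷ All-≤-truncateFrom zero a P P≤
All-≤-truncateFrom (suc i) a (x ∷ P) (x≤ ∷ P≤) = x≤ ∷ All-≤-truncateFrom i a P P≤

All-≤-map-⊓ : ∀ a {P} → All (_≤ n) P → All (_≤ n ⊓ a) (map (_⊓ a) P)
All-≤-map-⊓ a []         = []
All-≤-map-⊓ a (x≤ ∷ P≤) = ⊓-monoˡ-≤ a x≤ ∷ All-≤-map-⊓ a P≤

AllPairs-≥-truncateFrom : ∀ i a P → AllPairs _≥_ P → AllPairs _≥_ (truncateFrom i a P)
AllPairs-≥-truncateFrom zero    _ []      []         = []
AllPairs-≥-truncateFrom (suc _) _ []      []         = []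
AllPairs-≥-truncateFrom zero    a (x ∷ P) (x≥ ∷ P≥) = All-≤-map-⊓ a x≥ ∷ AllPairs-≥-truncateFrom zero a P P≥
AllPairs-≥-truncateFrom (suc i) a (x ∷ P) (x≥ ∷ P≥) = All-≤-truncateFrom i a P x≥ ∷ AllPairs-≥-truncateFrom i a P P≥

chompMove-isPosition : ∀ i a P → IsPosition P → IsPosition (chompMove i a P)
chompMove-isPosition i a P (P≥ , _) =
  Linked.filter⁺ (0 <?_) (flip ≤-trans)
    (Linked.AllPairs⇒Linked (AllPairs-≥-truncateFrom i a P (Linked.Linked⇒AllPairs (flip ≤-trans) P≥)))
  , All.all-filter (0 <?_) (truncateFrom i a P)

chompMove-volume-≤ : ∀ i a P → volume (chompMove i a P) ≤ volume P
chompMove-volume-≤ i a P = subst (_≤ sum P) (sym (sum-normalize (truncateFrom i a P))) (sum-truncateFrom-≤ i a P)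

chompMove-volume-< : ∀ i a P → IsPosition P → ¬ chompMove i a P ≡ P → volume (chompMove i a P) < volume P
chompMove-volume-< i a P (_ , P>0) Q≢P with m≤n⇒m<n∨m≡n (chompMove-volume-≤ i a P)
... | inj₁ volume< = volume<
... | inj₂ volume≡ = contradiction
  (begin
    normalize (truncateFrom i a P)
      ≡⟨ cong normalize (sum-truncateFrom-≡⇒≡ i a P (trans (sym (sum-normalize (truncateFrom i a P))) volume≡)) ⟩
    normalize P
      ≡⟨ filter-all (0 <?_) P>0 ⟩
    P ∎)
  Q≢P
  where open ≡-Reasoning

∈-Mov⁻ : ∀ {Q} P → Q ∈ Mov P → ∃[ i ] ∃[ a ] Q ≡ chompMove i a P × ¬ Q ≡ P
∈-Mov⁻ P Q∈ with ∈-filter⁻ (λ Q → ¬? (≡-dec _≟ℕ_ Q P)) Q∈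
... | Q∈moves , Q≢P
  with satisfied (∈-concatMap⁻ (λ i → map (λ a → chompMove i a P) (upTo (suc (volume P))))
                                {upTo (length P)} Q∈moves)
... | i , Q∈movesᵢ with ∈-map⁻ (λ a → chompMove i a P) Q∈movesᵢ
... | a , _ , Q≡ = i , a , Q≡ , Q≢P

Mov-isPosition : ∀ {Q} P → IsPosition P → Q ∈ Mov P → IsPosition Q
Mov-isPosition P pos Q∈ with ∈-Mov⁻ P Q∈
... | i , a , refl , _ = chompMove-isPosition i a P pos

Mov-volume-< : ∀ {Q} P → IsPosition P → Q ∈ Mov P → volume Q < volume P
Mov-volume-< P pos Q∈ with ∈-Mov⁻ P Q∈
... | i , a , refl , Q≢P = chompMove-volume-< i a P pos Q≢P

normalize-map-⊓0 : ∀ P → normalize (map (_⊓ 0) P) ≡ []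
normalize-map-⊓0 []      = refl
normalize-map-⊓0 (x ∷ P) rewrite ⊓-zeroʳ x = normalize-map-⊓0 P

[]∈Mov : ∀ x P → [] ∈ Mov (x ∷ P)
[]∈Mov x P = subst (_∈ Mov (x ∷ P)) (normalize-map-⊓0 (x ∷ P))
  (∈-filter⁺ (λ Q → ¬? (≡-dec _≟ℕ_ Q (x ∷ P))) (here refl) []≢x∷P)
  where
  []≢x∷P : ¬ normalize (map (_⊓ 0) (x ∷ P)) ≡ x ∷ P
  []≢x∷P eq with trans (sym (normalize-map-⊓0 (x ∷ P))) eq
  ... | ()

module _ {c ℓ₁ ℓ₂ : Level} (O : StrictTotalOrder c ℓ₁ ℓ₂) where
  open StrictTotalOrder O using (compare; irrefl; <-respˡ-≈; module Eq)
    renaming (_<_ to _⊏_; trans to ⊏-trans; Carrier to V)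
  open Ordinal O

  private
    variable
      k : ℕ
      α : Fin k → V
      j : Fin k
      l : List (Fin k)

  IsMaximum : (Fin k → V) → List (Fin k) → Fin k → Set ℓ₂
  IsMaximum α l j = j ∈ l × All (λ i → ¬ α j ⊏ α i) l

  best-nothing : best α l ≡ nothing → l ≡ []
  best-nothing {l = []} _ = refl
  best-nothing {α = α} {l = i ∷ is} eq with best α is
  ... | nothing = case eq of λ ()
  ... | just j with compare (α i) (α j)
  ...   | tri< _ _ _ = case eq of λ ()
  ...   | tri≈ _ _ _ = case eq of λ ()
  ...   | tri> _ _ _ = case eq of λ ()

  best-just : best α l ≡ just j → IsMaximum α l j
  best-just {α = α} {l = i ∷ is} eq with best α is in eqᵢₛ
  ... | nothing with refl ← best-nothing {l = is} eqᵢₛ | refl ← eq = here refl , irrefl Eq.refl ∷ []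
  ... | just j′ with compare (α i) (α j′)
  ...   | tri< _ _ αj′≮αi with refl ← eq =
    there (proj₁ (best-just eqᵢₛ)) , αj′≮αi ∷ proj₂ (best-just eqᵢₛ)
  ...   | tri≈ _ αi≈αj′ _ with refl ← eq =
    here refl , irrefl Eq.refl ∷ All.map (λ αj′≮ αi⊏ → αj′≮ (<-respˡ-≈ αi≈αj′ αi⊏)) (proj₂ (best-just eqᵢₛ))
  ...   | tri> _ _ αj′⊏αi with refl ← eq =
    here refl , irrefl Eq.refl ∷ All.map (λ αj′≮ αi⊏ → αj′≮ (⊏-trans αj′⊏αi αi⊏)) (proj₂ (best-just eqᵢₛ))

  IsMaximum⇒best : Distinct α → IsMaximum α l j → best α l ≡ just j
  IsMaximum⇒best {α = α} {l = l} {j = j} distinct (j∈ , j-max) with best α l in eq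
  ... | nothing = case subst (j ∈_) (best-nothing eq) j∈ of λ ()
  ... | just j′ with best-just eq
  ...   | j′∈ , j′-max with compare (α j′) (α j)
  ...     | tri< αj′⊏αj _ _ = contradiction αj′⊏αj (All.lookup j′-max j∈)
  ...     | tri≈ _ αj′≈αj _ = cong just (distinct j′ j αj′≈αj)
  ...     | tri> _ _ αj⊏αj′ = contradiction αj⊏αj′ (All.lookup j-max j′∈)

  best-reflect : ∀ {k l} {α : Fin l → V} (ι : Fin k → Fin l) → Distinct (α ∘ ι) →
                 {A : List (Fin l)} {B : List (Fin k)} {j : Fin k} →
                 All (λ b → ι b ∈ A) B → j ∈ B → best α A ≡ just (ι j) → best (α ∘ ι) B ≡ just j
  best-reflect ι distinct ιB⊆A j∈B eq =
    IsMaximum⇒best distinct (j∈B , All.map (All.lookup (proj₂ (best-just eq))) ιB⊆A)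

  Distinct-inject≤ : ∀ {α : Fin n → V} (m≤n : m ≤ n) → Distinct α → Distinct (λ i → α (inject≤ i m≤n))
  Distinct-inject≤ m≤n distinct i j αi≈αj = toℕ-injective
    (trans (sym (toℕ-inject≤ i m≤n)) (trans (cong toℕ (distinct _ _ αi≈αj)) (toℕ-inject≤ j m≤n)))

  toℕ-sIndex : o < suc n → toℕ (sIndex {n} o) ≡ o
  toℕ-sIndex {o} {n} o<1+n with o <? suc n
  ... | yes o<1+n′ = toℕ-fromℕ< o<1+n′
  ... | no  o≮1+n  = contradiction o<1+n o≮1+n

  sIndex-≮ : ¬ o < suc n → sIndex {n} o ≡ F.zero
  sIndex-≮ {o} {n} o≮1+n with o <? suc n
  ... | yes o<1+n = contradiction o<1+n o≮1+n
  ... | no  _     = refl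

  inject≤-sIndex : (m≤n : suc m ≤ suc n) → o < suc m → inject≤ (sIndex {m} o) m≤n ≡ sIndex {n} o
  inject≤-sIndex {m} {n} {o} m≤n o<1+m = toℕ-injective (begin
    toℕ (inject≤ (sIndex {m} o) m≤n) ≡⟨ toℕ-inject≤ (sIndex {m} o) m≤n ⟩
    toℕ (sIndex {m} o)               ≡⟨ toℕ-sIndex o<1+m ⟩
    o                                ≡⟨ sym (toℕ-sIndex (<-≤-trans o<1+m m≤n)) ⟩
    toℕ (sIndex {n} o)               ∎)
    where open ≡-Reasoning

  toOrd : Maybe (Fin k) → ℕ
  toOrd nothing  = 0
  toOrd (just i) = suc (toℕ i)

  ordFuel-unfold : ∀ n (α : Fin (suc n) → V) k P →
    ordFuel (suc n) α (suc k) P ≡ toOrd (best α (map (λ Q → sIndex {n} (ordFuel (suc n) α k Q)) (Mov P)))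
  ordFuel-unfold n α k P with best α (map (λ Q → sIndex {n} (ordFuel (suc n) α k Q)) (Mov P))
  ... | nothing = refl
  ... | just _  = refl

  ordFuel-irrelevant : ∀ N (α : Fin N → V) k k′ P → IsPosition P → volume P < k → volume P < k′ →
                       ordFuel N α k P ≡ ordFuel N α k′ P
  ordFuel-irrelevant zero    α _       _        _ _   _        _         = refl
  ordFuel-irrelevant (suc N) α (suc k) (suc k′) P pos vol<1+k vol<1+k′ = begin
    ordFuel (suc N) α (suc k) P
      ≡⟨ ordFuel-unfold N α k P ⟩
    toOrd (best α (map (λ Q → sIndex (ordFuel (suc N) α k Q)) (Mov P)))
      ≡⟨ cong (toOrd ∘ best α) (map-cong-local (All.tabulate (λ Q∈ → cong sIndex
           (ordFuel-irrelevant (suc N) α k k′ _ (Mov-isPosition P pos Q∈)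
             (<-≤-trans (Mov-volume-< P pos Q∈) (s≤s⁻¹ vol<1+k))
             (<-≤-trans (Mov-volume-< P pos Q∈) (s≤s⁻¹ vol<1+k′)))))) ⟩
    toOrd (best α (map (λ Q → sIndex (ordFuel (suc N) α k′ Q)) (Mov P)))
      ≡⟨ sym (ordFuel-unfold N α k′ P) ⟩
    ordFuel (suc N) α (suc k′) P ∎
    where open ≡-Reasoning

  ord-unfold : ∀ n (α : Fin (suc n) → V) P → IsPosition P →
               ord (suc n) α P ≡ toOrd (best α (map (sIndex {n} ∘ ord (suc n) α) (Mov P)))
  ord-unfold n α P pos = trans (ordFuel-unfold n α (volume P) P)
    (cong (toOrd ∘ best α) (map-cong-local (All.tabulate (λ {Q} Q∈ → cong sIndex
      (ordFuel-irrelevant (suc n) α (volume P) (suc (volume Q)) Q (Mov-isPosition P pos Q∈)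
        (Mov-volume-< P pos Q∈) (n<1+n (volume Q)))))))

  module Restriction {m n : ℕ} (m<n : suc m < suc n) (α : Fin (suc n) → V) (distinct : Distinct α) where

    α↾ : Fin (suc m) → V
    α↾ i = α (inject≤ i (<⇒≤ m<n))

    -- os are the ordinals of the moves of a nonempty position (0 is that of the empty move).
    toOrd-best-restrict : ∀ os → All (_≤ suc m) os → 0 ∈ os → toOrd (best α (map (sIndex {n}) os)) ≤ suc m →
                          toOrd (best α↾ (map (sIndex {m}) os)) ≡ toOrd (best α (map (sIndex {n}) os))
    toOrd-best-restrict os os≤1+m 0∈os ord≤1+m with best α (map (sIndex {n}) os) in eq
    ... | nothing = case subst (sIndex {n} 0 ∈_) (best-nothing eq) (∈-map⁺ sIndex 0∈os) of λ ()
    ... | just j with ∈-map⁻ (sIndex {n}) (proj₁ (best-just eq))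
    ...   | o , o∈os , refl = begin
      toOrd (best α↾ (map (sIndex {m}) os))
        ≡⟨ cong toOrd (best-reflect ι (Distinct-inject≤ (<⇒≤ m<n) distinct)
             (All.map⁺ (All.tabulate ι-sIndex-∈)) (∈-map⁺ sIndex o∈os)
             (trans eq (cong just (sym (inject≤-sIndex (<⇒≤ m<n) o<1+m))))) ⟩
      suc (toℕ (sIndex {m} o))
        ≡⟨ cong suc (sym (toℕ-inject≤ (sIndex {m} o) (<⇒≤ m<n))) ⟩
      suc (toℕ (ι (sIndex {m} o)))
        ≡⟨ cong (suc ∘ toℕ) (inject≤-sIndex (<⇒≤ m<n) o<1+m) ⟩
      suc (toℕ (sIndex {n} o)) ∎
      where
      open ≡-Reasoning
      ι : Fin (suc m) → Fin (suc n)
      ι i = inject≤ i (<⇒≤ m<n)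
      o<1+m : o < suc m
      o<1+m = s≤s (subst (_≤ m) (toℕ-sIndex (≤-<-trans (All.lookup os≤1+m o∈os) m<n)) (s≤s⁻¹ ord≤1+m))
      -- an ordinal m + 1 yields α₁ under g, which f already sees through the empty move
      ι-sIndex-∈ : ∀ {o′} → o′ ∈ os → ι (sIndex {m} o′) ∈ map (sIndex {n}) os
      ι-sIndex-∈ {o′} o′∈os = case o′ <? suc m of λ where
        (yes o′<1+m) → subst (_∈ _) (sym (inject≤-sIndex (<⇒≤ m<n) o′<1+m)) (∈-map⁺ sIndex o′∈os)
        (no  o′≮1+m) → subst (λ i → ι i ∈ _) (sym (sIndex-≮ o′≮1+m)) (∈-map⁺ sIndex 0∈os)

    ord-restrict : (∀ P → InL P → ord (suc n) α P ≤ suc m) →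
                   ∀ P → IsPosition P → ord (suc n) α P ≡ ord (suc m) α↾ P
    ord-restrict bounded P pos = go (suc (volume P)) P pos (n<1+n (volume P))
      where
      ord-≤ : ∀ Q → IsPosition Q → ord (suc n) α Q ≤ suc m
      ord-≤ []      _   = z≤n
      ord-≤ (x ∷ Q) pos = bounded (x ∷ Q) (pos , λ ())
      go : ∀ k P → IsPosition P → volume P < k → ord (suc n) α P ≡ ord (suc m) α↾ P
      go (suc k) []      _   _        = refl
      go (suc k) (x ∷ P) pos vol<1+k = begin
        ord (suc n) α (x ∷ P)                      ≡⟨ ord-f ⟩
        toOrd (best α (map sIndex os))             ≡⟨ sym (toOrd-best-restrict os os≤1+m 0∈os
                                                          (subst (_≤ suc m) ord-f (ord-≤ (x ∷ P) pos))) ⟩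
        toOrd (best α↾ (map sIndex os))            ≡⟨ cong (toOrd ∘ best α↾) (trans (sym (map-∘ (Mov (x ∷ P))))
                                                        (map-cong-local (All.tabulate (λ Q∈ → cong sIndex
                                                          (go k _ (Mov-isPosition _ pos Q∈) (vol< Q∈)))))) ⟩
        toOrd (best α↾ (map (sIndex ∘ ord (suc m) α↾) (Mov (x ∷ P))))
                                                   ≡⟨ sym (ord-unfold m α↾ (x ∷ P) pos) ⟩
        ord (suc m) α↾ (x ∷ P) ∎
        where
        open ≡-Reasoning
        os : List ℕ
        os = map (ord (suc n) α) (Mov (x ∷ P))
        ord-f : ord (suc n) α (x ∷ P) ≡ toOrd (best α (map sIndex os))
        ord-f = trans (ord-unfold n α (x ∷ P) pos) (cong (toOrd ∘ best α) (map-∘ (Mov (x ∷ P))))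
        vol< : ∀ {Q} → Q ∈ Mov (x ∷ P) → volume Q < k
        vol< Q∈ = <-≤-trans (Mov-volume-< _ pos Q∈) (s≤s⁻¹ vol<1+k)
        os≤1+m : All (_≤ suc m) os
        os≤1+m = All.map⁺ (All.tabulate (λ Q∈ → ord-≤ _ (Mov-isPosition _ pos Q∈)))
        0∈os : 0 ∈ os
        0∈os = ∈-map⁺ (ord (suc n) α) ([]∈Mov x P)

theorem3p5 : {c ℓ₁ ℓ₂ : Level} (O : StrictTotalOrder c ℓ₁ ℓ₂)
    (n : ℕ) (α : Fin n → StrictTotalOrder.Carrier O) → Ordinal.Distinct O α →
    (m : ℕ) → 0 < m → (m<n : m < n) →
    (∀ (P : List ℕ) → InL P → Ordinal.ord O n α P ≤ m) →
    ∀ (P : List ℕ) → InL P →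
      Ordinal.ord O n α P ≡ Ordinal.ord O m (λ i → α (inject≤ i (<⇒≤ m<n))) P
theorem3p5 O zero    α distinct m       _  ()  bounded P _
theorem3p5 O (suc n) α distinct zero    () m<n bounded P _
theorem3p5 O (suc n) α distinct (suc m) _  m<n bounded P (pos , _) =
  Restriction.ord-restrict O m<n α distinct bounded P pos
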